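{- Let $F$ be a CNF formula and let $\pi$ be a derivation from $F$ (in the DSR/WSR sense). Then $F\vDash \mathrm{ctx}(\pi).\mathrm{acc}(F,\pi)$, i.e., every assignment satisfying $F$ satisfies the dynamic constraint $\mathrm{ctx}(\pi).D$ for every $D\in\mathrm{acc}(F,\pi)$.
   Context: Fix a nonempty set of variables; assignments map variables to $\{0,1\}$. Literals are $x$, $\neg x$, $\top$, $\bot$ with the usual satisfaction ($I\vDash\top$ always, $I\vDash\bot$ never); complements $\overline{x}=\neg x$, $\overline{\neg x}=x$, $\overline\top=\bot$, $\overline\bot=\top$. A substitution $\sigma$ maps literals to literals with $\sigma(\top)=\top$, $\sigma(\overline l)=\overline{\sigma(l)}$; finite if $\sigma(x)=x$ for all but finitely many variables. $I\circ\sigma$ is the assignment with $(I\circ\sigma)(x)=1$ iff $I\vDash\sigma(x)$. A clause $l_1\vee\dots\vee l_n$ ($n\ge1$, $l_i$ literals) is satisfied iff some $l_i$ is; a cube $l_1\wedge\dots\wedge l_n$ iff all $l_i$ are. Negation: $\overline{l_1\vee\dots\vee l_n}=\overline{l_1}\wedge\dots\wedge\overline{l_n}$ and $\overline{l_1\wedge\dots\wedge l_n}=\overline{l_1}\vee\dots\vee\overline{l_n}$; reduct: $(l_1\vee\dots\vee l_n)|_\sigma=\sigma(l_1)\vee\dots\vee\sigma(l_n)$, similarly for cubes (so $I\vDash C|_\sigma$ iff $I\circ\sigma\vDash C$). A literal $l$ is identified with the one-literal clause $l$. A CNF formula is a finite set of clauses and cubes, satisfied iff all members are. $\mathrm{Conf}(F)$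 (unit propagation conflict) holds iff the following procedure reaches a conflict: start with the set $L$ consisting of $\top$ and all literals of cubes in $F$; repeatedly, if $F$ contains a clause $l_1\vee\dots\vee l_n$ and some $i$ with $\overline{l_j}\in L$ for all $j\neq i$, add $l_i$ to $L$; a conflict is reached when $L$ contains some literal together with its complement. DSR/WSR: a clause $C$ is RUP over a CNF formula $F$ if $\mathrm{Conf}(F\cup\{\overline C\})$; $C$ is SR over $F$ upon a substitution $\sigma$ if $\mathrm{Conf}(\{\overline{C|_\sigma}\})$ and $\mathrm{Conf}(F\cup\{\overline C,\overline{D|_\sigma}\})$ for all $D\in F$; $C$ is WSR over $F$ upon $\sigma$ modulo a CNF formula $G$ if $\mathrm{Conf}(F\cup\{\overline C,\overline{D|_\sigma}\})$ for all $D\in (F\setminus G)\cup\{C\}$. Instructions are $\mathrm{del}\,C$, $\mathrm{rup}\,C$, $\mathrm{sr}(C,\sigma)$, $\mathrm{wsr}(C,\sigma,G)$ for clauses $C$, finite substitutions $\sigma$, CNF formulas $G$. For a list of instructions $\pi$ ($\mathrm{nil}$ empty, juxtaposition appends): $\mathrm{acc}(F,\mathrm{nil})=F$, $\mathrm{acc}(F,\pi\,\mathrm{del}\,C)=\mathrm{acc}(F,\pi)\setminus\{C\}$, $\mathrm{acc}(F,\pi\,\mathrm{rup}\,C)=\mathrm{acc}(F,\pi\,\mathrm{sr}(C,\sigma))=\mathrm{acc}(F,\pi)\cup\{C\}$, $\mathrm{acc}(F,\pi\,\mathrm{wsr}(C,\sigma,G))=(\mathrm{acc}(F,\pi)\setminus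 G)\cup\{C\}$. Derivations from $F$: $\mathrm{nil}$ is one; $\pi\,\mathrm{del}\,C$ is one if $\pi$ is; $\pi\,\mathrm{rup}\,C$ (resp. $\pi\,\mathrm{sr}(C,\sigma)$, $\pi\,\mathrm{wsr}(C,\sigma,G)$) is one if $\pi$ is and $C$ is RUP over (resp. SR upon $\sigma$ over, WSR upon $\sigma$ modulo $G$ over) $\mathrm{acc}(F,\pi)$. Programs: a program is a finite list of program items; among program items are $\langle\sigma\rangle$ for a finite substitution $\sigma$ with $I\otimes J\vDash\langle\sigma\rangle$ iff $J=I\circ\sigma$, and branches $\mathrm{if}(T)\{\varepsilon\}$ for a cube or clause $T$ and a program $\varepsilon$, with $I\otimes J\vDash\mathrm{if}(T)\{\varepsilon\}$ iff either $I\vDash T$ and $I\otimes J\vDash\varepsilon$, or $I\not\vDash T$ and $J=I$. For a list $\lambda_1\cdots\lambda_n$, $I\otimes J\vDash\lambda_1\cdots\lambda_n$ iff there are $I_0=I,\dots,I_n=J$ with $I_{i-1}\otimes I_i\vDash\lambda_i$ ($1\le i\le n$). A dynamic constraint $\varepsilon.D$ is satisfied by $I$ iff $J\vDash D$ for all $J$ with $I\otimes J\vDash\varepsilon$; for a set $H$, $\varepsilon.H=\{\varepsilon.D:D\in H\}$, satisfied iff all members are. The context of an instruction list is defined by $\mathrm{ctx}(\mathrm{nil})=\mathrm{nil}$, $\mathrm{ctx}(\pi\,\mathrm{del}\,C)=\mathrm{ctx}(\pi\,\mathrm{rup}\,C)=\mathrm{ctx}(\pi)$, and $\mathrm{ctx}(\pi\,\mathrm{sr}(C,\sigma))=\mathrm{ctx}(\pi\,\mathrm{wsr}(C,\sigma,G))=\mathrm{ctx}(\pi)\,\mathrm{if}(\overline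 C)\{\langle\sigma\rangle\}$. -}

module Defs where

open import Data.Bool using (Bool; true; false; _∧_; _∨_; not)
open import Data.List using (List; []; _∷_; _++_; [_])
open import Data.List.NonEmpty using (List⁺; toList)
open import Data.List.Relation.Unary.Any using (Any)
open import Data.List.Relation.Unary.All using (All)
open import Data.List.Membership.Propositional using (_∈_; _∉_)
open import Data.Fin using (Fin)
open import Data.List using (length; lookup)
open import Data.Product using (Σ; ∃; _×_; _,_)
open import Data.Sum using (_⊎_)
open import Relation.Nullary using (¬_)
open import Relation.Binary.PropositionalEquality using (_≡_; _≢_)

variable
  V : Set

data Lit (V : Set) : Set where
  pos : V → Lit V
  neg : V → Lit V
  top : Lit V
  bot : Lit V

compl : Lit V → Lit V
compl (pos x) = neg x
compl (neg x) = pos x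
compl top = bot
compl bot = top

Assignment : Set → Set
Assignment V = V → Bool

evalLit : Assignment V → Lit V → Bool
evalLit I (pos x) = I x
evalLit I (neg x) = not (I x)
evalLit I top = true
evalLit I bot = false

_⊨ˡ_ : Assignment V → Lit V → Set
I ⊨ˡ l = evalLit I l ≡ true

-- Finite substitutions: determined by their values on variables
-- (σ(⊤)=⊤, σ(¬l)=complement of σ(l)), identity outside a finite support.
record Subst (V : Set) : Set where
  field
    fun  : V → Lit V
    supp : List V
    fin  : ∀ x → x ∉ supp → fun x ≡ pos x
open Subst public

applyLit : Subst V → Lit V → Lit V
applyLit σ (pos x) = fun σ x
applyLit σ (neg x) = compl (fun σ x)
applyLit σ top = top
applyLit σ bot = bot

_∘ˢ_ : Assignment V → Subst V → Assignment V
(I ∘ˢ σ) x = evalLit I (fun σ x)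

data Con (V : Set) : Set where
  clause : List⁺ (Lit V) → Con V
  cube   : List⁺ (Lit V) → Con V

mapLits : (Lit V → Lit V) → List⁺ (Lit V) → List⁺ (Lit V)
mapLits = Data.List.NonEmpty.map

negCon : Con V → Con V
negCon (clause ls) = cube (mapLits compl ls)
negCon (cube ls) = clause (mapLits compl ls)

reduct : Con V → Subst V → Con V
reduct (clause ls) σ = clause (mapLits (applyLit σ) ls)
reduct (cube ls) σ = cube (mapLits (applyLit σ) ls)

_⊨ᶜ_ : Assignment V → Con V → Set
I ⊨ᶜ clause ls = Any (I ⊨ˡ_) (toList ls)
I ⊨ᶜ cube ls = All (I ⊨ˡ_) (toList ls)

-- Formulas as (membership) predicates on constraints; a CNF formula is
-- given concretely as a finite list.
Formula : Set → Set₁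
Formula V = Con V → Set

⟦_⟧ : List (Con V) → Formula V
⟦ F ⟧ D = D ∈ F

_∪₁_ : Formula V → Con V → Formula V
(F ∪₁ C) D = F D ⊎ D ≡ C

_∖_ : Formula V → List (Con V) → Formula V
(F ∖ G) D = F D × D ∉ G

_∖₁_ : Formula V → Con V → Formula V
(F ∖₁ C) D = F D × D ≢ C

single : Con V → Formula V
single C D = D ≡ C

_⊨F_ : Assignment V → Formula V → Set
I ⊨F F = ∀ D → F D → I ⊨ᶜ D

-- Unit propagation: the set L of literals reached by the procedure
-- (least set closed under the rules).
litAt : (ls : List⁺ (Lit V)) → Fin (length (toList ls)) → Lit V
litAt ls i = lookup (toList ls) i

data Reached (F : Formula V) : Lit V → Set where
  r-top  : Reached F top
  r-cube : ∀ {ls l} → F (cube ls) → l ∈ toList ls → Reached F l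
  r-unit : ∀ {ls} → F (clause ls) → (i : Fin (length (toList ls))) →
           (∀ j → j ≢ i → Reached F (compl (litAt ls j))) →
           Reached F (litAt ls i)

Conf : Formula V → Set
Conf F = ∃ λ l → Reached F l × Reached F (compl l)

data Instr (V : Set) : Set where
  del : Con V → Instr V
  rup : Con V → Instr V
  sr  : Con V → Subst V → Instr V
  wsr : Con V → Subst V → List (Con V) → Instr V

data Instrs (V : Set) : Set where
  nil : Instrs V
  _▹_ : Instrs V → Instr V → Instrs V

RUP : Formula V → Con V → Set
RUP F C = Conf (F ∪₁ negCon C)

SR : Formula V → Con V → Subst V → Set
SR F C σ = Conf (single (negCon (reduct C σ)))
         × (∀ D → F D → Conf ((F ∪₁ negCon C) ∪₁ negCon (reduct D σ)))

WSR : Formula V → Con V → Subst V → List (Con V) → Set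
WSR F C σ G = ∀ D → ((F ∖ G) ∪₁ C) D →
              Conf ((F ∪₁ negCon C) ∪₁ negCon (reduct D σ))

acc : List (Con V) → Instrs V → Formula V
acc F nil = ⟦ F ⟧
acc F (π ▹ del C) = acc F π ∖₁ C
acc F (π ▹ rup C) = acc F π ∪₁ C
acc F (π ▹ sr C σ) = acc F π ∪₁ C
acc F (π ▹ wsr C σ G) = (acc F π ∖ G) ∪₁ C

Derivation : List (Con V) → Instrs V → Set
Derivation F nil = Data.Unit.⊤ where import Data.Unit
Derivation F (π ▹ del C) = Derivation F π
Derivation F (π ▹ rup C) = Derivation F π × RUP (acc F π) C
Derivation F (π ▹ sr C σ) = Derivation F π × SR (acc F π) C σ
Derivation F (π ▹ wsr C σ G) = Derivation F π × WSR (acc F π) C σ G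

data Item (V : Set) : Set where
  ⟨_⟩  : Subst V → Item V
  if_then_ : Con V → List (Item V) → Item V

_≗_ : Assignment V → Assignment V → Set
I ≗ J = ∀ x → I x ≡ J x

mutual
  _⊗_⊨ᵢ_ : Assignment V → Assignment V → Item V → Set
  I ⊗ J ⊨ᵢ ⟨ σ ⟩ = J ≗ (I ∘ˢ σ)
  I ⊗ J ⊨ᵢ (if T then ε) = (I ⊨ᶜ T × I ⊗ J ⊨ᵖ ε) ⊎ (¬ (I ⊨ᶜ T) × J ≗ I)

  _⊗_⊨ᵖ_ : Assignment V → Assignment V → List (Item V) → Set
  I ⊗ J ⊨ᵖ [] = J ≗ I
  I ⊗ J ⊨ᵖ (λ₁ ∷ ε) = ∃ λ K → I ⊗ K ⊨ᵢ λ₁ × K ⊗ J ⊨ᵖ ε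

_⊨dyn_∙_ : Assignment V → List (Item V) → Con V → Set
I ⊨dyn ε ∙ D = ∀ J → I ⊗ J ⊨ᵖ ε → J ⊨ᶜ D

ctx : Instrs V → List (Item V)
ctx nil = []
ctx (π ▹ del C) = ctx π
ctx (π ▹ rup C) = ctx π
ctx (π ▹ sr C σ) = ctx π ++ [ if negCon C then [ ⟨ σ ⟩ ] ]
ctx (π ▹ wsr C σ G) = ctx π ++ [ if negCon C then [ ⟨ σ ⟩ ] ]

-- Induction on the derivation, with the invariant that every assignment reached
-- from a model of F by running ctx(π) satisfies acc(F, π).  Unit propagation is
-- sound, so each RUP/SR/WSR side condition says that certain constraints hold in
-- every model of the current formula.  A new branch if(¬C){⟨σ⟩} either does not
-- fire, and then the current assignment K already satisfies C, or it fires from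
-- a K violating C, and then the side conditions say that K satisfies every
-- retained constraint D under the reduct, i.e. K ∘ σ ⊨ D.
module Submission where

open import Defs
open import Data.Bool using (true; false; not)
open import Data.Bool.Properties using (not-involutive) renaming (_≟_ to _≟ᵇ_)
open import Data.Fin using () renaming (_≟_ to _≟ᶠ_)
open import Data.List using (List; []; _∷_; _++_; [_])
open import Data.List.NonEmpty using (toList)
open import Data.List.Relation.Unary.All as All using (all?)
import Data.List.Relation.Unary.All.Properties as All
open import Data.List.Relation.Unary.Any as Any using (any?)
import Data.List.Relation.Unary.Any.Properties as Any
open import Data.Product using (∃; _×_; _,_)
open import Data.Sum using (inj₁; inj₂)
open import Relation.Nullary using (¬_; Dec; yes; no; contradiction)
open import Relation.Binary.PropositionalEquality using (_≡_; refl; sym; trans; cong)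

module _ {V : Set} where

  evalLit-compl : (I : Assignment V) (l : Lit V) → evalLit I (compl l) ≡ not (evalLit I l)
  evalLit-compl I (pos x) = refl
  evalLit-compl I (neg x) = sym (not-involutive (I x))
  evalLit-compl I top     = refl
  evalLit-compl I bot     = refl

  ⊨ˡ-compl⁺ : ∀ {I : Assignment V} l → ¬ I ⊨ˡ l → I ⊨ˡ compl l
  ⊨ˡ-compl⁺ {I} l ¬l with evalLit I l | evalLit-compl I l
  ... | true  | _  = contradiction refl ¬l
  ... | false | eq = eq

  ⊨ˡ-compl⁻ : ∀ {I : Assignment V} l → I ⊨ˡ compl l → ¬ I ⊨ˡ l
  ⊨ˡ-compl⁻ {I} l l̄ with evalLit I l | evalLit-compl I l
  ... | true  | eq = λ _ → contradiction (trans (sym eq) l̄) λ ()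
  ... | false | _  = λ ()

  _⊨ˡ?_ : (I : Assignment V) (l : Lit V) → Dec (I ⊨ˡ l)
  I ⊨ˡ? l = evalLit I l ≟ᵇ true

  _⊨ᶜ?_ : (I : Assignment V) (C : Con V) → Dec (I ⊨ᶜ C)
  I ⊨ᶜ? clause ls = any? (I ⊨ˡ?_) (toList ls)
  I ⊨ᶜ? cube ls   = all? (I ⊨ˡ?_) (toList ls)

  ⊨ᶜ-negCon⁺ : ∀ {I : Assignment V} C → ¬ I ⊨ᶜ C → I ⊨ᶜ negCon C
  ⊨ᶜ-negCon⁺ (clause ls) ¬C =
    All.map⁺ {f = compl} (All.map (λ {l} → ⊨ˡ-compl⁺ l) (All.¬Any⇒All¬ (toList ls) ¬C))
  ⊨ᶜ-negCon⁺ {I} (cube ls) ¬C =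
    Any.map⁺ {f = compl} (Any.map (λ {l} → ⊨ˡ-compl⁺ l) (All.¬All⇒Any¬ (I ⊨ˡ?_) (toList ls) ¬C))

  ⊨ᶜ-¬negCon : ∀ {I : Assignment V} C → ¬ I ⊨ᶜ negCon C → I ⊨ᶜ C
  ⊨ᶜ-¬negCon {I} C ¬C̄ with I ⊨ᶜ? C
  ... | yes c = c
  ... | no ¬c = contradiction (⊨ᶜ-negCon⁺ C ¬c) ¬C̄

  evalLit-applyLit : (I : Assignment V) (σ : Subst V) (l : Lit V) →
                     evalLit I (applyLit σ l) ≡ evalLit (I ∘ˢ σ) l
  evalLit-applyLit I σ (pos x) = refl
  evalLit-applyLit I σ (neg x) = evalLit-compl I (fun σ x)
  evalLit-applyLit I σ top     = refl
  evalLit-applyLit I σ bot     = refl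

  ⊨ᶜ-reduct⁻ : ∀ {I : Assignment V} {σ} D → I ⊨ᶜ reduct D σ → (I ∘ˢ σ) ⊨ᶜ D
  ⊨ᶜ-reduct⁻ {I} {σ} (clause ls) D|σ =
    Any.map (λ {l} → trans (sym (evalLit-applyLit I σ l))) (Any.map⁻ D|σ)
  ⊨ᶜ-reduct⁻ {I} {σ} (cube ls) D|σ =
    All.map (λ {l} → trans (sym (evalLit-applyLit I σ l))) (All.map⁻ D|σ)

  evalLit-resp-≗ : ∀ {I J : Assignment V} → I ≗ J → ∀ l → evalLit I l ≡ evalLit J l
  evalLit-resp-≗ I≗J (pos x) = I≗J x
  evalLit-resp-≗ I≗J (neg x) = cong not (I≗J x)
  evalLit-resp-≗ I≗J top     = refl
  evalLit-resp-≗ I≗J bot     = refl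

  ⊨ᶜ-resp-≗ : ∀ {I J : Assignment V} → J ≗ I → ∀ D → I ⊨ᶜ D → J ⊨ᶜ D
  ⊨ᶜ-resp-≗ J≗I (clause ls) = Any.map λ {l} → trans (evalLit-resp-≗ J≗I l)
  ⊨ᶜ-resp-≗ J≗I (cube ls)   = All.map λ {l} → trans (evalLit-resp-≗ J≗I l)

  ⊨F-∪₁ : ∀ {I : Assignment V} {F C} → I ⊨F F → I ⊨ᶜ C → I ⊨F (F ∪₁ C)
  ⊨F-∪₁ I⊨F ⊨C D (inj₁ D∈F) = I⊨F D D∈F
  ⊨F-∪₁ I⊨F ⊨C D (inj₂ refl) = ⊨C

  Reached-sound : ∀ {I : Assignment V} {F l} → I ⊨F F → Reached F l → I ⊨ˡ l
  Reached-sound I⊨F r-top                = refl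
  Reached-sound I⊨F (r-cube cube∈F l∈ls) = All.lookup (I⊨F _ cube∈F) l∈ls
  Reached-sound {I} I⊨F (r-unit {ls} clause∈F i others) =
    unit (Any.index ⊨clause) (Any.lookup-index ⊨clause)
    where
      ⊨clause : I ⊨ᶜ clause ls
      ⊨clause = I⊨F _ clause∈F
      unit : ∀ k → I ⊨ˡ litAt ls k → I ⊨ˡ litAt ls i
      unit k ⊨k with k ≟ᶠ i
      ... | yes refl = ⊨k
      ... | no  k≢i  = contradiction ⊨k
                         (⊨ˡ-compl⁻ {I} (litAt ls k) (Reached-sound I⊨F (others k k≢i)))

  Conf-unsat : ∀ {I : Assignment V} {F} → I ⊨F F → ¬ Conf F
  Conf-unsat I⊨F (l , l∈L , l̄∈L) =
    ⊨ˡ-compl⁻ l (Reached-sound I⊨F l̄∈L) (Reached-sound I⊨F l∈L)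

  RUP-sound : ∀ {I : Assignment V} {F} C → I ⊨F F → RUP F C → I ⊨ᶜ C
  RUP-sound C I⊨F conf = ⊨ᶜ-¬negCon C λ ⊨C̄ → Conf-unsat (⊨F-∪₁ I⊨F ⊨C̄) conf

  reduct-test-sound : ∀ {K : Assignment V} {F} C σ D → K ⊨F F → K ⊨ᶜ negCon C →
    Conf ((F ∪₁ negCon C) ∪₁ negCon (reduct D σ)) → (K ∘ˢ σ) ⊨ᶜ D
  reduct-test-sound C σ D K⊨F ⊨C̄ conf =
    ⊨ᶜ-reduct⁻ D (RUP-sound (reduct D σ) (⊨F-∪₁ K⊨F ⊨C̄) conf)

  ⊨ᵖ-snoc⁻ : ∀ {I J : Assignment V} ε it → I ⊗ J ⊨ᵖ (ε ++ [ it ]) →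
             ∃ λ K → I ⊗ K ⊨ᵖ ε × ∃ λ K′ → K ⊗ K′ ⊨ᵢ it × J ≗ K′
  ⊨ᵖ-snoc⁻ {I} [] it (K , I→K , K→J) = I , (λ _ → refl) , K , I→K , K→J
  ⊨ᵖ-snoc⁻ (it′ ∷ ε) it (K , I→K , K→J) with ⊨ᵖ-snoc⁻ ε it K→J
  ... | K₁ , K→K₁ , K₂ , K₁→K₂ , J≗K₂ = K₁ , (K , I→K , K→K₁) , K₂ , K₁→K₂ , J≗K₂

  branch-preserves : ∀ {K K′ : Assignment V} {H : Formula V} C σ →
    (K ⊨ᶜ negCon C → (K ∘ˢ σ) ⊨F H) → (¬ K ⊨ᶜ negCon C → K ⊨F H) →
    K ⊗ K′ ⊨ᵢ (if negCon C then [ ⟨ σ ⟩ ]) → K′ ⊨F H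
  branch-preserves C σ fired _ (inj₁ (⊨C̄ , K₁ , K₁≗Kσ , K′≗K₁)) D D∈H =
    ⊨ᶜ-resp-≗ (λ x → trans (K′≗K₁ x) (K₁≗Kσ x)) D (fired ⊨C̄ D D∈H)
  branch-preserves C σ _ skipped (inj₂ (¬C̄ , K′≗K)) D D∈H =
    ⊨ᶜ-resp-≗ K′≗K D (skipped ¬C̄ D D∈H)

  snoc-branch-preserves : ∀ {I J : Assignment V} {H : Formula V} ε C σ →
    (∀ {K} → I ⊗ K ⊨ᵖ ε → K ⊨ᶜ negCon C → (K ∘ˢ σ) ⊨F H) →
    (∀ {K} → I ⊗ K ⊨ᵖ ε → ¬ K ⊨ᶜ negCon C → K ⊨F H) →
    I ⊗ J ⊨ᵖ (ε ++ [ if negCon C then [ ⟨ σ ⟩ ] ]) → J ⊨F H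
  snoc-branch-preserves ε C σ fired skipped I→J
    with K , I→K , K′ , K→K′ , J≗K′ ← ⊨ᵖ-snoc⁻ ε _ I→J =
    λ D D∈H → ⊨ᶜ-resp-≗ J≗K′ D
                (branch-preserves C σ (fired I→K) (skipped I→K) K→K′ D D∈H)

  acc-invariant : ∀ F π → Derivation F π → ∀ {I J : Assignment V} →
    I ⊨F ⟦ F ⟧ → I ⊗ J ⊨ᵖ ctx π → J ⊨F acc F π
  acc-invariant F nil _ I⊨F I→J D D∈F = ⊨ᶜ-resp-≗ I→J D (I⊨F D D∈F)
  acc-invariant F (π ▹ del C) d I⊨F I→J D (D∈acc , _) =
    acc-invariant F π d I⊨F I→J D D∈acc
  acc-invariant F (π ▹ rup C) (d , refuted) {J = J} I⊨F I→J =
    ⊨F-∪₁ ⊨acc (RUP-sound C ⊨acc refuted)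
    where
      ⊨acc : J ⊨F acc F π
      ⊨acc = acc-invariant F π d I⊨F I→J
  acc-invariant F (π ▹ sr C σ) (d , C|σ-valid , tests) {I} I⊨F =
    snoc-branch-preserves (ctx π) C σ fired skipped
    where
      fired : ∀ {K} → I ⊗ K ⊨ᵖ ctx π → K ⊨ᶜ negCon C → (K ∘ˢ σ) ⊨F (acc F π ∪₁ C)
      fired I→K ⊨C̄ D (inj₁ D∈acc) =
        reduct-test-sound C σ D (acc-invariant F π d I⊨F I→K) ⊨C̄ (tests D D∈acc)
      fired I→K ⊨C̄ D (inj₂ refl) = ⊨ᶜ-reduct⁻ D (⊨ᶜ-¬negCon (reduct D σ)
        λ ⊨D̄ → Conf-unsat (λ { _ refl → ⊨D̄ }) C|σ-valid)
      skipped : ∀ {K} → I ⊗ K ⊨ᵖ ctx π → ¬ K ⊨ᶜ negCon C → K ⊨F (acc F π ∪₁ C)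
      skipped I→K ¬C̄ = ⊨F-∪₁ (acc-invariant F π d I⊨F I→K) (⊨ᶜ-¬negCon C ¬C̄)
  acc-invariant F (π ▹ wsr C σ G) (d , tests) {I} I⊨F =
    snoc-branch-preserves (ctx π) C σ fired skipped
    where
      fired : ∀ {K} → I ⊗ K ⊨ᵖ ctx π → K ⊨ᶜ negCon C → (K ∘ˢ σ) ⊨F ((acc F π ∖ G) ∪₁ C)
      fired I→K ⊨C̄ D D∈ =
        reduct-test-sound C σ D (acc-invariant F π d I⊨F I→K) ⊨C̄ (tests D D∈)
      skipped : ∀ {K} → I ⊗ K ⊨ᵖ ctx π → ¬ K ⊨ᶜ negCon C → K ⊨F ((acc F π ∖ G) ∪₁ C)
      skipped I→K ¬C̄ = ⊨F-∪₁ (λ D (D∈acc , _) → acc-invariant F π d I⊨F I→K D D∈acc)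
                              (⊨ᶜ-¬negCon C ¬C̄)

theorem3 : {V : Set} → V → (F : List (Con V)) → (π : Instrs V) →
    Derivation F π →
    ∀ (I : Assignment V) → I ⊨F ⟦ F ⟧ →
    ∀ (D : Con V) → acc F π D → I ⊨dyn ctx π ∙ D
theorem3 _ F π d I I⊨F D D∈acc J I→J = acc-invariant F π d I⊨F I→J D D∈acc
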